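{- For every type $A$, $A\equiv\bigwedge PF(A)$, where $\bigwedge[A_1,\dots,A_n]$ denotes $A_1\wedge\cdots\wedge A_n$.
   Context: Types: $A ::= X \mid A\Rightarrow A \mid A\wedge A \mid \forall X.A$, $X$ type variables, modulo $\alpha$-equivalence; $\Rightarrow$ associates to the right. Type isomorphism $\equiv$ is the smallest congruence on types containing: $A\wedge B\equiv B\wedge A$; $A\wedge(B\wedge C)\equiv(A\wedge B)\wedge C$; $A\Rightarrow(B\wedge C)\equiv(A\Rightarrow B)\wedge(A\Rightarrow C)$; $(A\wedge B)\Rightarrow C\equiv A\Rightarrow B\Rightarrow C$; $\forall X.(A\Rightarrow B)\equiv A\Rightarrow\forall X.B$ if $X\notin FTV(A)$; $\forall X.(A\wedge B)\equiv\forall X.A\wedge\forall X.B$. Write $\forall\vec X.A$ for $\forall X_1\dots\forall X_n.A$ ($n\ge 0$). Prime factors $PF(A)$ (a multiset of types, each of the form $\forall\vec X.(B\Rightarrow Y)$ with $Y$ a type variable, where a factor $\forall\vec X.Y$ is regarded as the case with empty antecedent) are defined by: $PF(X)=[X]$; $PF(A\Rightarrow B)=[\forall\vec X_i.((A\wedge B_i)\Rightarrow Y_i)]_{i=1}^n$ where $PF(B)=[\forall\vec X_i.(B_i\Rightarrow Y_i)]_{i=1}^n$ (with $A\wedge B_i$ read as $A$ when the antecedent $B_i$ is empty, and bound variables renamed to avoid capture); $PF(A\wedge B)=PF(A)\uplus PF(B)$; $PF(\forall X.A)=[\forall X.\forall\vec Y_i.(A_i\Rightarrow Z_i)]_{i=1}^n$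 where $PF(A)=[\forall\vec Y_i.(A_i\Rightarrow Z_i)]_{i=1}^n$. -}

module Defs where

open import Data.Nat using (ℕ; zero; suc; _+_; _<ᵇ_)
open import Data.Bool using (if_then_else_)
open import Data.Maybe using (Maybe; just; nothing)
open import Data.List.NonEmpty using (List⁺; [_]; _⁺++⁺_; foldr₁)
import Data.List.NonEmpty as L⁺

-- Types, with type variables as de Bruijn indices (so types are
-- automatically taken modulo α-equivalence).  A free variable with
-- index i (outside all binders) is the i-th free type variable.
infixr 7 _⇒_
infixr 8 _∧_
data Ty : Set where
  var : ℕ → Ty
  _⇒_ : Ty → Ty → Ty
  _∧_ : Ty → Ty → Ty
  ∀' : Ty → Ty

shift : ℕ → ℕ → Ty → Ty
shift c k (var i) = if i <ᵇ c then var i else var (i + k)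
shift c k (A ⇒ B) = shift c k A ⇒ shift c k B
shift c k (A ∧ B) = shift c k A ∧ shift c k B
shift c k (∀' A) = ∀' (shift (suc c) k A)

wk : Ty → Ty
wk = shift 0 1

infix 4 _≡ᵢ_
data _≡ᵢ_ : Ty → Ty → Set where
  ≡-refl  : ∀ {A} → A ≡ᵢ A
  ≡-sym   : ∀ {A B} → A ≡ᵢ B → B ≡ᵢ A
  ≡-trans : ∀ {A B C} → A ≡ᵢ B → B ≡ᵢ C → A ≡ᵢ C
  ≡-⇒ : ∀ {A A' B B'} → A ≡ᵢ A' → B ≡ᵢ B' → (A ⇒ B) ≡ᵢ (A' ⇒ B')
  ≡-∧ : ∀ {A A' B B'} → A ≡ᵢ A' → B ≡ᵢ B' → (A ∧ B) ≡ᵢ (A' ∧ B')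
  ≡-∀ : ∀ {A A'} → A ≡ᵢ A' → ∀' A ≡ᵢ ∀' A'
  comm     : ∀ {A B} → (A ∧ B) ≡ᵢ (B ∧ A)
  asso     : ∀ {A B C} → (A ∧ (B ∧ C)) ≡ᵢ ((A ∧ B) ∧ C)
  dist     : ∀ {A B C} → (A ⇒ (B ∧ C)) ≡ᵢ ((A ⇒ B) ∧ (A ⇒ C))
  curry    : ∀ {A B C} → ((A ∧ B) ⇒ C) ≡ᵢ (A ⇒ B ⇒ C)
  -- ∀X.(A ⇒ B) ≡ A ⇒ ∀X.B with X ∉ FTV(A): in de Bruijn form the
  -- antecedent under the binder is a weakening of A.
  p-comm   : ∀ {A B} → ∀' (wk A ⇒ B) ≡ᵢ (A ⇒ ∀' B)
  p-dist   : ∀ {A B} → ∀' (A ∧ B) ≡ᵢ (∀' A ∧ ∀' B)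

-- A prime factor  ∀X₁…∀Xₖ.(B ⇒ Y)  (or  ∀X₁…∀Xₖ.Y  when the antecedent
-- is empty): number of binders k, optional antecedent, target variable.
record Factor : Set where
  constructor factor
  field
    binders : ℕ
    ante    : Maybe Ty
    target  : ℕ
open Factor

∀ⁿ : ℕ → Ty → Ty
∀ⁿ zero    A = A
∀ⁿ (suc n) A = ∀' (∀ⁿ n A)

factorTy : Factor → Ty
factorTy (factor k nothing  y) = ∀ⁿ k (var y)
factorTy (factor k (just B) y) = ∀ⁿ k (B ⇒ var y)

-- A ⇒ (∀X⃗.(B ⇒ Y)) ↦ ∀X⃗.((A ∧ B) ⇒ Y), A shifted past the k binders
addAnte : Ty → Factor → Factor
addAnte A (factor k nothing  y) = factor k (just (shift 0 k A)) y
addAnte A (factor k (just B) y) = factor k (just (shift 0 k A ∧ B)) y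

addBinder : Factor → Factor
addBinder (factor k b y) = factor (suc k) b y

-- Prime factors (a multiset, represented as a nonempty list)
PF : Ty → List⁺ Factor
PF (var x)  = [ factor 0 nothing x ]
PF (A ⇒ B) = L⁺.map (addAnte A) (PF B)
PF (A ∧ B) = PF A ⁺++⁺ PF B
PF (∀' A)  = L⁺.map addBinder (PF A)

⋀ : List⁺ Ty → Ty
⋀ = foldr₁ _∧_

-- Each clause of PF mirrors an isomorphism: A ⇒ _ distributes over the
-- conjunction of factors (dist), is pushed under the binders of each factor
-- (p-comm) and merged into its antecedent (curry); ∀' distributes over the
-- conjunction (p-dist); and ∧ concatenates the factor lists up to
-- associativity.
module Submission where

open import Defs
open import Data.List.NonEmpty using (List⁺; _∷_; _⁺++⁺_; map)
open import Data.List.NonEmpty.Properties using (map-∘; map-cong; map-⁺++⁺)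
open import Data.List using ([]; _∷_)
open import Data.Nat using (zero; suc; _+_; _<ᵇ_)
open import Data.Nat.Properties using (+-assoc; +-identityʳ)
open import Data.Bool using (true; false)
open import Data.Maybe using (just; nothing)
open import Level using (0ℓ)
open import Relation.Binary.Bundles using (Setoid)
open import Relation.Binary.PropositionalEquality using (_≡_; refl; sym; cong; cong₂)

≡ᵢ-setoid : Setoid 0ℓ 0ℓ
≡ᵢ-setoid = record
  { Carrier       = Ty
  ; _≈_           = _≡ᵢ_
  ; isEquivalence = record { refl = ≡-refl ; sym = ≡-sym ; trans = ≡-trans }
  }

open import Relation.Binary.Reasoning.Setoid ≡ᵢ-setoid

≡⇒≡ᵢ : ∀ {A B} → A ≡ B → A ≡ᵢ B
≡⇒≡ᵢ refl = ≡-refl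

<ᵇ-false-+ : ∀ i m c → (i <ᵇ c) ≡ false → (i + m <ᵇ c) ≡ false
<ᵇ-false-+ i       m zero    _  = refl
<ᵇ-false-+ (suc i) m (suc c) eq = <ᵇ-false-+ i m c eq

shift-identity : ∀ c A → shift c 0 A ≡ A
shift-identity c (var i) with i <ᵇ c
... | true  = refl
... | false = cong var (+-identityʳ i)
shift-identity c (A ⇒ B) = cong₂ _⇒_ (shift-identity c A) (shift-identity c B)
shift-identity c (A ∧ B) = cong₂ _∧_ (shift-identity c A) (shift-identity c B)
shift-identity c (∀' A)  = cong ∀' (shift-identity (suc c) A)

shift-+ : ∀ c m k A → shift c k (shift c m A) ≡ shift c (m + k) A
shift-+ c m k (var i) with i <ᵇ c in i<ᵇc
... | true  rewrite i<ᵇc = refl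
... | false rewrite <ᵇ-false-+ i m c i<ᵇc = cong var (+-assoc i m k)
shift-+ c m k (A ⇒ B) = cong₂ _⇒_ (shift-+ c m k A) (shift-+ c m k B)
shift-+ c m k (A ∧ B) = cong₂ _∧_ (shift-+ c m k A) (shift-+ c m k B)
shift-+ c m k (∀' A)  = cong ∀' (shift-+ (suc c) m k A)

∀ⁿ-cong : ∀ k {A B} → A ≡ᵢ B → ∀ⁿ k A ≡ᵢ ∀ⁿ k B
∀ⁿ-cong zero    A≡B = A≡B
∀ⁿ-cong (suc k) A≡B = ≡-∀ (∀ⁿ-cong k A≡B)

∀ⁿ-p-comm : ∀ k A B → ∀ⁿ k (shift 0 k A ⇒ B) ≡ᵢ (A ⇒ ∀ⁿ k B)
∀ⁿ-p-comm zero    A B = ≡⇒≡ᵢ (cong (_⇒ B) (shift-identity 0 A))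
∀ⁿ-p-comm (suc k) A B = begin
  ∀' (∀ⁿ k (shift 0 (suc k) A ⇒ B)) ≡⟨ cong (λ A′ → ∀' (∀ⁿ k (A′ ⇒ B))) (sym (shift-+ 0 1 k A)) ⟩
  ∀' (∀ⁿ k (shift 0 k (wk A) ⇒ B))  ≈⟨ ≡-∀ (∀ⁿ-p-comm k (wk A) B) ⟩
  ∀' (wk A ⇒ ∀ⁿ k B)                ≈⟨ p-comm ⟩
  A ⇒ ∀ⁿ (suc k) B                  ∎

factorTy-addAnte : ∀ A f → factorTy (addAnte A f) ≡ᵢ (A ⇒ factorTy f)
factorTy-addAnte A (factor k nothing  y) = ∀ⁿ-p-comm k A (var y)
factorTy-addAnte A (factor k (just B) y) =
  ≡-trans (∀ⁿ-cong k curry) (∀ⁿ-p-comm k A (B ⇒ var y))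

factorTy-addBinder : ∀ f → factorTy (addBinder f) ≡ ∀' (factorTy f)
factorTy-addBinder (factor k nothing  y) = refl
factorTy-addBinder (factor k (just B) y) = refl

module _ {X : Set} where

  ⋀-map-cong : ∀ {f g : X → Ty} → (∀ x → f x ≡ᵢ g x) →
               ∀ xs → ⋀ (map f xs) ≡ᵢ ⋀ (map g xs)
  ⋀-map-cong {f} {g} f≡g (x ∷ xs) = go x xs
    where
    go : ∀ x xs → ⋀ (map f (x ∷ xs)) ≡ᵢ ⋀ (map g (x ∷ xs))
    go x []       = f≡g x
    go x (y ∷ xs) = ≡-∧ (f≡g x) (go y xs)

  ⇒-⋀ : ∀ A (f : X → Ty) xs → (A ⇒ ⋀ (map f xs)) ≡ᵢ ⋀ (map (λ x → A ⇒ f x) xs)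
  ⇒-⋀ A f (x ∷ xs) = go x xs
    where
    go : ∀ x xs → (A ⇒ ⋀ (map f (x ∷ xs))) ≡ᵢ ⋀ (map (λ x → A ⇒ f x) (x ∷ xs))
    go x []       = ≡-refl
    go x (y ∷ xs) = ≡-trans dist (≡-∧ ≡-refl (go y xs))

  ∀-⋀ : ∀ (f : X → Ty) xs → ∀' (⋀ (map f xs)) ≡ᵢ ⋀ (map (λ x → ∀' (f x)) xs)
  ∀-⋀ f (x ∷ xs) = go x xs
    where
    go : ∀ x xs → ∀' (⋀ (map f (x ∷ xs))) ≡ᵢ ⋀ (map (λ x → ∀' (f x)) (x ∷ xs))
    go x []       = ≡-refl
    go x (y ∷ xs) = ≡-trans p-dist (≡-∧ ≡-refl (go y xs))

⋀-⁺++⁺ : ∀ xs ys → (⋀ xs ∧ ⋀ ys) ≡ᵢ ⋀ (xs ⁺++⁺ ys)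
⋀-⁺++⁺ (x ∷ xs) ys = go x xs
  where
  go : ∀ x xs → (⋀ (x ∷ xs) ∧ ⋀ ys) ≡ᵢ ⋀ ((x ∷ xs) ⁺++⁺ ys)
  go x []       = ≡-refl
  go x (y ∷ xs) = ≡-trans (≡-sym asso) (≡-∧ ≡-refl (go y xs))

mainTheorem4 : ∀ (A : Ty) → A ≡ᵢ ⋀ (map factorTy (PF A))
mainTheorem4 (var x) = ≡-refl
mainTheorem4 (A ⇒ B) = begin
  A ⇒ B                                         ≈⟨ ≡-⇒ ≡-refl (mainTheorem4 B) ⟩
  A ⇒ ⋀ (map factorTy (PF B))                   ≈⟨ ⇒-⋀ A factorTy (PF B) ⟩
  ⋀ (map (λ f → A ⇒ factorTy f) (PF B))         ≈⟨ ⋀-map-cong (λ f → ≡-sym (factorTy-addAnte A f)) (PF B) ⟩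
  ⋀ (map (λ f → factorTy (addAnte A f)) (PF B)) ≡⟨ cong ⋀ (map-∘ (PF B)) ⟩
  ⋀ (map factorTy (PF (A ⇒ B)))                 ∎
mainTheorem4 (A ∧ B) = begin
  A ∧ B                                                  ≈⟨ ≡-∧ (mainTheorem4 A) (mainTheorem4 B) ⟩
  ⋀ (map factorTy (PF A)) ∧ ⋀ (map factorTy (PF B))      ≈⟨ ⋀-⁺++⁺ (map factorTy (PF A)) (map factorTy (PF B)) ⟩
  ⋀ (map factorTy (PF A) ⁺++⁺ map factorTy (PF B))       ≡⟨ cong ⋀ (sym (map-⁺++⁺ factorTy (PF A) (PF B))) ⟩
  ⋀ (map factorTy (PF (A ∧ B)))                          ∎
mainTheorem4 (∀' A) = begin
  ∀' A                                          ≈⟨ ≡-∀ (mainTheorem4 A) ⟩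
  ∀' (⋀ (map factorTy (PF A)))                  ≈⟨ ∀-⋀ factorTy (PF A) ⟩
  ⋀ (map (λ f → ∀' (factorTy f)) (PF A))        ≡⟨ cong ⋀ (map-cong (λ f → sym (factorTy-addBinder f)) (PF A)) ⟩
  ⋀ (map (λ f → factorTy (addBinder f)) (PF A)) ≡⟨ cong ⋀ (map-∘ (PF A)) ⟩
  ⋀ (map factorTy (PF (∀' A)))                  ∎
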